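{- Let $G$ be a graph, $k$ a positive integer, and $V_1,\dots,V_t$ a partition of $V(G)$ into types, each designated a clique type or an independent type. If the system of constraints (C0)–(C7) below in the integer variables $n_A$, $A\subseteq\{1,\dots,t\}$, has a feasible (integer) assignment, then $G$ has a star coloring using at most $k$ colors. (C0) $n_A=0$ for every $A$ containing two indices $i,j$ with $V_j\in adj(V_i)$ (such subset types are discarded). (C1) $\sum_{A\subseteq[t]} n_A\le k$. (C2) For each clique type $V_i$: $\sum_{A\ni i} n_A=|V_i|$. (C3) For each independent type $V_i$: $1\le \sum_{A\ni i} n_A\le \min\{k,|V_i|\}$. (C4) For every four distinct indices $i_1,i_2,i_3,i_4$ with $V_{i_1},V_{i_3}\in adj(V_{i_2})$ and $V_{i_4}\in adj(V_{i_3})$: if $\sum_{A\ni i_1,i_3} n_A\ge 1$ then $\sum_{B\ni i_2,i_4} n_B=0$. (C5) For every three distinct indices $i_1,i_2,i_3$ with $V_{i_1}$ an independent type and $V_{i_2},V_{i_3}\in adj(V_{i_1})$: if $\sum_{A\ni i_1} n_A<|V_{i_1}|$ then $\sum_{B\ni i_2,i_3} n_B=0$. (C6) For every two distinct independent types $V_{i_1},V_{i_2}$ with $V_{i_1}\in adj(V_{i_2})$: if $\sum_{A\ni i_1} n_A<|V_{i_1}|$ then $\sum_{B\ni i_2} n_B=|V_{i_2}|$, and if $\sum_{A\ni i_2} n_A<|V_{i_2}|$ then $\sum_{B\ni i_1} n_B=|V_{i_1}|$. (C7) $n_A\ge 0$ for all $A\subseteq[t]$.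
   Context: A star coloring of $G$ is a map $f:V(G)\to\{1,\dots,k\}$ that is a proper coloring and such that every path on four vertices receives at least three distinct colors. Two vertices $u,v$ have the same type if $N(u)\setminus\{v\}=N(v)\setminus\{u\}$; $V_1,\dots,V_t$ is a partition of $V(G)$ into sets whose vertices pairwise have the same type, so each $V_i$ induces either a clique (clique type) or an independent set (independent type), and for distinct $i,j$ either every vertex of $V_i$ is adjacent to every vertex of $V_j$ or none is. $adj(V_i)$ denotes the set of types $V_j$ ($j\ne i$) all of whose vertices are adjacent to all vertices of $V_i$. $[t]=\{1,\dots,t\}$, and sums $\sum_{A\ni i}$ range over subsets $A\subseteq[t]$ containing $i$. Intuitively $n_A$ is the number of colors used in every type $V_i$ with $i\in A$ and in no type $V_j$ with $j\notin A$. -}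

module Defs where

open import Data.Nat as ℕ using (ℕ; zero; suc; _⊓_)
open import Data.Integer as ℤ using (ℤ; +_)
open import Data.Fin using (Fin; _≟_)
open import Data.Fin.Subset using (Subset; _∈_)
open import Data.Fin.Subset.Properties using (_∈?_)
open import Data.Bool using (Bool; true; false)
open import Data.Vec using (Vec; []; _∷_; lookup)
open import Data.List using (List; []; _∷_; map; filter; length; allFin; _++_)
open import Data.Product using (Σ; _×_; ∃; ∃-syntax)
open import Relation.Nullary using (¬_; Dec)
open import Relation.Nullary.Decidable using (_×-dec_)
open import Relation.Binary.PropositionalEquality using (_≡_; _≢_)

record SimpleGraph (n : ℕ) : Set₁ where
  field
    E      : Fin n → Fin n → Set
    sym    : ∀ {u v} → E u v → E v u
    irrefl : ∀ {u} → ¬ E u u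

open SimpleGraph public

Proper : ∀ {n k} → SimpleGraph n → (Fin n → Fin k) → Set
Proper G f = ∀ u v → E G u v → f u ≢ f v

IsP4 : ∀ {n} → SimpleGraph n → Fin n → Fin n → Fin n → Fin n → Set
IsP4 G a b c d =
  a ≢ b × a ≢ c × a ≢ d × b ≢ c × b ≢ d × c ≢ d ×
  E G a b × E G b c × E G c d

AtLeastThreeColours : ∀ {n k} → (Fin n → Fin k) → Fin n → Fin n → Fin n → Fin n → Set
AtLeastThreeColours f a b c d =
  let w = lookup (a ∷ b ∷ c ∷ d ∷ []) in
  ∃[ p ] ∃[ q ] ∃[ r ]
    (f (w p) ≢ f (w q) × f (w q) ≢ f (w r) × f (w p) ≢ f (w r))

StarColoring : ∀ {n k} → SimpleGraph n → (Fin n → Fin k) → Set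
StarColoring G f =
  Proper G f × (∀ a b c d → IsP4 G a b c d → AtLeastThreeColours f a b c d)

SameType : ∀ {n} → SimpleGraph n → Fin n → Fin n → Set
SameType G u v = ∀ w → w ≢ u → w ≢ v → (E G u w → E G w v) × (E G v w → E G w u)

-- A partition of V(G) into t (nonempty) parts V_i = τ⁻¹(i), whose vertices
-- pairwise have the same type, each part designated clique type
-- (cliq i ≡ true) or independent type (cliq i ≡ false) consistently.
record TypePartition {n : ℕ} (G : SimpleGraph n) (t : ℕ) : Set where
  field
    τ        : Fin n → Fin t
    nonempty : ∀ i → ∃[ v ] τ v ≡ i
    sameType : ∀ u v → τ u ≡ τ v → SameType G u v
    cliq     : Fin t → Bool
    cliqOK   : ∀ u v → τ u ≡ τ v → u ≢ v → cliq (τ u) ≡ true → E G u v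
    indepOK  : ∀ u v → τ u ≡ τ v → cliq (τ u) ≡ false → ¬ E G u v

open TypePartition public

module _ {n t : ℕ} {G : SimpleGraph n} (P : TypePartition G t) where

  size : Fin t → ℕ
  size i = length (filter (λ v → τ P v ≟ i) (allFin n))

  Adj : Fin t → Fin t → Set
  Adj i j = i ≢ j × (∀ u v → τ P u ≡ i → τ P v ≡ j → E G u v)

allSubsets : (t : ℕ) → List (Subset t)
allSubsets zero    = [] ∷ []
allSubsets (suc t) = map (true ∷_) (allSubsets t) ++ map (false ∷_) (allSubsets t)

sumℤ : List ℤ → ℤ
sumℤ []       = + 0
sumℤ (x ∷ xs) = x ℤ.+ sumℤ xs

ΣAll : ∀ {t} → (Subset t → ℤ) → ℤ
ΣAll {t} x = sumℤ (map x (allSubsets t))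

Σ∋ : ∀ {t} → (Subset t → ℤ) → Fin t → ℤ
Σ∋ {t} x i = sumℤ (map x (filter (i ∈?_) (allSubsets t)))

Σ∋₂ : ∀ {t} → (Subset t → ℤ) → Fin t → Fin t → ℤ
Σ∋₂ {t} x i j = sumℤ (map x (filter (λ A → (i ∈? A) ×-dec (j ∈? A)) (allSubsets t)))

module _ {n t : ℕ} {G : SimpleGraph n} (P : TypePartition G t) (k : ℕ) (x : Subset t → ℤ) where

  C0 C1 C2 C3 C4 C5 C6 C7 : Set
  C0 = ∀ A i j → i ∈ A → j ∈ A → Adj P i j → x A ≡ + 0
  C1 = ΣAll x ℤ.≤ + k
  C2 = ∀ i → cliq P i ≡ true → Σ∋ x i ≡ + size P i
  C3 = ∀ i → cliq P i ≡ false → (+ 1 ℤ.≤ Σ∋ x i) × (Σ∋ x i ℤ.≤ + (k ⊓ size P i))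
  C4 = ∀ i₁ i₂ i₃ i₄ →
       i₁ ≢ i₂ → i₁ ≢ i₃ → i₁ ≢ i₄ → i₂ ≢ i₃ → i₂ ≢ i₄ → i₃ ≢ i₄ →
       Adj P i₂ i₁ → Adj P i₂ i₃ → Adj P i₃ i₄ →
       + 1 ℤ.≤ Σ∋₂ x i₁ i₃ → Σ∋₂ x i₂ i₄ ≡ + 0
  C5 = ∀ i₁ i₂ i₃ → i₁ ≢ i₂ → i₁ ≢ i₃ → i₂ ≢ i₃ →
       cliq P i₁ ≡ false → Adj P i₁ i₂ → Adj P i₁ i₃ →
       Σ∋ x i₁ ℤ.< + size P i₁ → Σ∋₂ x i₂ i₃ ≡ + 0
  C6 = ∀ i₁ i₂ → i₁ ≢ i₂ → cliq P i₁ ≡ false → cliq P i₂ ≡ false → Adj P i₂ i₁ →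
       (Σ∋ x i₁ ℤ.< + size P i₁ → Σ∋ x i₂ ≡ + size P i₂) ×
       (Σ∋ x i₂ ℤ.< + size P i₂ → Σ∋ x i₁ ≡ + size P i₁)
  C7 = ∀ A → + 0 ℤ.≤ x A

  Feasible : Set
  Feasible = C0 × C1 × C2 × C3 × C4 × C5 × C6 × C7

-- Take n_A colours for each set A of types and give each vertex of type i a colour whose
-- set contains i: distinct ones within V_i while they last, the surplus vertices all
-- sharing the last one, which by (C2) happens only in an independent type. By (C0) no
-- colour is shared by two adjacent types, so the colouring is proper. In a bicoloured path
-- a-b-c-d either an edge joins the types of two equally coloured vertices (excluded by
-- (C0)), or an end type repeats a colour and so has fewer colours than vertices, against
-- (C5) or (C6), or the four types are distinct and (C4) is violated.
module Submission where

open import Defs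
open import Data.Nat using (ℕ; _<_)
open import Data.Integer using (ℤ)
open import Data.Fin using (Fin)
open import Data.Fin.Subset using (Subset)
open import Data.Product using (Σ; ∃-syntax)

open import Data.Bool using (true; false)
open import Data.Empty using (⊥; ⊥-elim)
open import Data.Nat using (suc; _+_; _≤_; _⊓_; s≤s; z<s; _≤?_)
open import Data.Nat.Properties as ℕ using (m⊓n≤n; m≤n⇒m⊓n≡m; ≤-pred; ≤-trans; ≰⇒>)
open import Data.Integer as ℤ using (+_; +≤+; +<+; ∣_∣)
open import Data.Integer.Properties as ℤ using (0≤i⇒+∣i∣≡i; drop‿+≤+; +-injective)
open import Data.Fin using (zero; suc; toℕ; fromℕ<; inject≤; _≟_)
open import Data.Fin.Properties using (suc-injective; toℕ<n; toℕ-injective; fromℕ<-injective; inject≤-injective)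
open import Data.Fin.Subset using (_∈_)
open import Data.Fin.Subset.Properties using (_∈?_)
open import Data.List using (List; []; _∷_; _++_; map; filter; length; allFin; concatMap; replicate; lookup)
open import Data.Nat.ListAction using (sum)
open import Data.List.Properties using (length-++; length-replicate; filter-++; filter-all; filter-none)
open import Data.List.Relation.Unary.All.Properties using (replicate⁺)
open import Data.List.Relation.Unary.Any using (here; there; index)
open import Data.List.Relation.Unary.Any.Properties using (lookup-index)
import Data.List.Membership.Propositional as Mem
open import Data.List.Membership.Propositional.Properties using (∈-++⁻; ∈-filter⁺; ∈-allFin; ∈-lookup)
open import Data.Product using (_×_; _,_; proj₁; proj₂)
open import Data.Sum using (inj₁; inj₂)
open import Function using (_∘_)
open import Relation.Nullary using (¬_; yes; no; _×-dec_)
open import Relation.Unary using (Pred; Decidable)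
open import Relation.Binary.PropositionalEquality as ≡
  using (_≡_; _≢_; refl; trans; cong; cong₂; subst; subst₂; module ≡-Reasoning)

∈-replicate⁻ : ∀ {a} {A : Set a} {n} {y z : A} → y Mem.∈ replicate n z → y ≡ z × 0 < n
∈-replicate⁻ {n = suc _} (here y≡z) = y≡z , z<s
∈-replicate⁻ {n = suc _} (there y∈) = proj₁ (∈-replicate⁻ y∈) , z<s

∈-filter⇒count-positive : ∀ {a p} {A : Set a} {Q : Pred A p} (Q? : Decidable Q) {xs} {y} →
                          y Mem.∈ xs → Q y → 0 < length (filter Q? xs)
∈-filter⇒count-positive Q? {xs} y∈ qy with filter Q? xs | ∈-filter⁺ Q? y∈ qy
... | _ ∷ _ | _ = z<s

positive⇒≢0 : ∀ {z} → + 1 ℤ.≤ z → z ≢ + 0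
positive⇒≢0 (+≤+ ()) refl

sumℤ-map-+ : ∀ {a} {A : Set a} (f : A → ℤ) (g : A → ℕ) → (∀ y → f y ≡ + g y) →
             ∀ xs → sumℤ (map f xs) ≡ + sum (map g xs)
sumℤ-map-+ f g f≡g []       = refl
sumℤ-map-+ f g f≡g (y ∷ ys) = cong₂ ℤ._+_ (f≡g y) (sumℤ-map-+ f g f≡g ys)

module _ {a p} {A : Set a} {Q : Pred A p} (Q? : Decidable Q) where

  select : (xs : List A) → Fin (length (filter Q? xs)) → Fin (length xs)
  select (y ∷ ys) j with Q? y
  select (y ∷ ys) zero    | yes _ = zero
  select (y ∷ ys) (suc j) | yes _ = suc (select ys j)
  select (y ∷ ys) j       | no _  = suc (select ys j)

  select-satisfies : ∀ xs j → Q (lookup xs (select xs j))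
  select-satisfies (y ∷ ys) j with Q? y
  select-satisfies (y ∷ ys) zero    | yes qy = qy
  select-satisfies (y ∷ ys) (suc j) | yes _  = select-satisfies ys j
  select-satisfies (y ∷ ys) j       | no _   = select-satisfies ys j

  select-injective : ∀ xs {i j} → select xs i ≡ select xs j → i ≡ j
  select-injective (y ∷ ys) {i} {j} eq with Q? y
  select-injective (y ∷ ys) {zero}  {zero}  eq | yes _ = refl
  select-injective (y ∷ ys) {suc i} {suc j} eq | yes _ =
    cong suc (select-injective ys (suc-injective eq))
  select-injective (y ∷ ys) {i}     {j}     eq | no _  =
    select-injective ys (suc-injective eq)

module _ {a} {A : Set a} (mult : A → ℕ) where

  expand : List A → List A
  expand = concatMap (λ y → replicate (mult y) y)

  length-expand : ∀ xs → length (expand xs) ≡ sum (map mult xs)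
  length-expand []       = refl
  length-expand (y ∷ ys) = begin
    length (replicate (mult y) y ++ expand ys)          ≡⟨ length-++ (replicate (mult y) y) ⟩
    length (replicate (mult y) y) + length (expand ys)  ≡⟨ cong₂ _+_ (length-replicate (mult y)) (length-expand ys) ⟩
    mult y + sum (map mult ys)                          ∎
    where open ≡-Reasoning

  filter-expand : ∀ {p} {Q : Pred A p} (Q? : Decidable Q) xs →
                  filter Q? (expand xs) ≡ expand (filter Q? xs)
  filter-expand Q? []       = refl
  filter-expand Q? (y ∷ ys) with Q? y
  ... | yes qy = trans (filter-++ Q? (replicate (mult y) y) (expand ys))
                       (cong₂ _++_ (filter-all Q? (replicate⁺ (mult y) qy)) (filter-expand Q? ys))
  ... | no ¬qy = trans (filter-++ Q? (replicate (mult y) y) (expand ys))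
                       (cong₂ _++_ (filter-none Q? (replicate⁺ (mult y) ¬qy)) (filter-expand Q? ys))

  count-expand : ∀ {p} {Q : Pred A p} (Q? : Decidable Q) xs →
                 length (filter Q? (expand xs)) ≡ sum (map mult (filter Q? xs))
  count-expand Q? xs = trans (cong length (filter-expand Q? xs)) (length-expand (filter Q? xs))

  ∈-expand⇒mult-positive : ∀ xs {y} → y Mem.∈ expand xs → 0 < mult y
  ∈-expand⇒mult-positive (z ∷ zs) y∈ with ∈-++⁻ (replicate (mult z) z) y∈
  ... | inj₂ y∈zs = ∈-expand⇒mult-positive zs y∈zs
  ... | inj₁ y∈rep with ∈-replicate⁻ y∈rep
  ...   | refl , positive = positive

clamp : ∀ {m s} → 0 < s → Fin m → Fin s
clamp {s = suc s} _ i = fromℕ< (s≤s (m⊓n≤n (toℕ i) s))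

clamp-injective : ∀ {m s} (0<s : 0 < s) → m ≤ s → ∀ {i j : Fin m} →
                  clamp 0<s i ≡ clamp 0<s j → i ≡ j
clamp-injective {s = suc s} _ m≤s {i} {j} eq = toℕ-injective (begin
    toℕ i      ≡⟨ ≡.sym (m≤n⇒m⊓n≡m (below i)) ⟩
    toℕ i ⊓ s  ≡⟨ fromℕ<-injective _ _ _ _ eq ⟩
    toℕ j ⊓ s  ≡⟨ m≤n⇒m⊓n≡m (below j) ⟩
    toℕ j      ∎)
  where
    open ≡-Reasoning
    below : ∀ l → toℕ l ≤ s
    below l = ≤-pred (≤-trans (toℕ<n l) m≤s)

StarColoring-∘-injective : ∀ {n c k} {G : SimpleGraph n} {f : Fin n → Fin c} (g : Fin c → Fin k) →
                           (∀ {i j} → g i ≡ g j → i ≡ j) → StarColoring G f → StarColoring G (g ∘ f)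
StarColoring-∘-injective {f = f} g g-injective (proper , threeColours) =
  (λ u v uv eq → proper u v uv (g-injective eq)) ,
  (λ a b c d p4 → transfer (threeColours a b c d p4))
  where
    transfer : ∀ {a b c d} → AtLeastThreeColours f a b c d → AtLeastThreeColours (g ∘ f) a b c d
    transfer (p , q , r , pq , qr , pr) = p , q , r , pq ∘ g-injective , qr ∘ g-injective , pr ∘ g-injective

module _ {n t} {G : SimpleGraph n} (P : TypePartition G t) where

  edge⇒Adj : ∀ {u v} → E G u v → τ P u ≢ τ P v → Adj P (τ P u) (τ P v)
  edge⇒Adj {u} {v} uv τu≢τv = τu≢τv , λ u′ v′ τu′≡τu τv′≡τv →
    let vu′ = proj₁ (sameType P u u′ (≡.sym τu′≡τu) v
                       (apart λ τv≡τu → τu≢τv (≡.sym τv≡τu))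
                       (apart λ τv≡τu′ → τu≢τv (trans (≡.sym τu′≡τu) (≡.sym τv≡τu′)))) uv
    in proj₁ (sameType P v v′ (≡.sym τv′≡τv) u′
                (apart λ τu′≡τv → τu≢τv (trans (≡.sym τu′≡τu) τu′≡τv))
                (apart λ τu′≡τv′ → τu≢τv (trans (≡.sym τu′≡τu) (trans τu′≡τv′ τv′≡τv)))) vu′
    where
      apart : ∀ {a b} → τ P a ≢ τ P b → a ≢ b
      apart τa≢τb a≡b = τa≢τb (cong (τ P) a≡b)

  rank : ∀ {i v} → τ P v ≡ i → Fin (size P i)
  rank {i} {v} τv≡i = index (∈-filter⁺ (λ w → τ P w ≟ i) (∈-allFin v) τv≡i)

  rank-injective : ∀ {i u v} (τu≡i : τ P u ≡ i) (τv≡i : τ P v ≡ i) → rank τu≡i ≡ rank τv≡i → u ≡ v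
  rank-injective {i} {u} {v} τu≡i τv≡i eq =
    trans (lookup-index (∈-filter⁺ (λ w → τ P w ≟ i) (∈-allFin u) τu≡i))
          (trans (cong (lookup (filter (λ w → τ P w ≟ i) (allFin n))) eq)
                 (≡.sym (lookup-index (∈-filter⁺ (λ w → τ P w ≟ i) (∈-allFin v) τv≡i))))

  size-positive : ∀ i → 0 < size P i
  size-positive i with size P i | rank (proj₂ (nonempty P i))
  ... | suc _ | _ = z<s

module Palette {n t} {G : SimpleGraph n} (P : TypePartition G t) (k : ℕ) (x : Subset t → ℤ)
               (c1 : C1 P k x) (c2 : C2 P k x) (c3 : C3 P k x) (c7 : C7 P k x) where

  mult : Subset t → ℕ
  mult A = ∣ x A ∣

  x≡+mult : ∀ A → x A ≡ + mult A
  x≡+mult A = ≡.sym (0≤i⇒+∣i∣≡i (c7 A))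

  -- A colour is a position in the palette, which lists every A ⊆ [t] exactly n_A times.
  palette : List (Subset t)
  palette = expand mult (allSubsets t)

  sumℤ-filter≡count : ∀ {p} {Q : Pred (Subset t) p} (Q? : Decidable Q) →
                      sumℤ (map x (filter Q? (allSubsets t))) ≡ + length (filter Q? palette)
  sumℤ-filter≡count Q? = trans (sumℤ-map-+ x mult x≡+mult (filter Q? (allSubsets t)))
                               (cong +_ (≡.sym (count-expand mult Q? (allSubsets t))))

  palette-fits : length palette ≤ k
  palette-fits = subst (_≤ k) (≡.sym (length-expand mult (allSubsets t)))
                   (drop‿+≤+ (subst (ℤ._≤ + k) (sumℤ-map-+ x mult x≡+mult (allSubsets t)) c1))

  slots : Fin t → ℕ
  slots i = length (filter (i ∈?_) palette)

  slots-positive : ∀ i → 0 < slots i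
  slots-positive i with cliq P i in cliqueType
  ... | true  = subst (0 <_) (+-injective (trans (≡.sym (c2 i cliqueType)) (sumℤ-filter≡count (i ∈?_))))
                      (size-positive P i)
  ... | false = drop‿+≤+ (subst (+ 1 ℤ.≤_) (sumℤ-filter≡count (i ∈?_)) (proj₁ (c3 i cliqueType)))

  colourAt : ∀ i {v} → τ P v ≡ i → Fin (length palette)
  colourAt i τv≡i = select (i ∈?_) palette (clamp (slots-positive i) (rank P τv≡i))

  colour : Fin n → Fin (length palette)
  colour v = colourAt (τ P v) refl

  colourAt≡colour : ∀ {i v} (τv≡i : τ P v ≡ i) → colourAt i τv≡i ≡ colour v
  colourAt≡colour refl = refl

  class : Fin (length palette) → Subset t
  class = lookup palette

  type∈class : ∀ v → τ P v ∈ class (colour v)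
  type∈class v = select-satisfies (τ P v ∈?_) palette _

  class-nonzero : ∀ c → x (class c) ≢ + 0
  class-nonzero c x≡0 = ℕ.<-irrefl (≡.sym (+-injective (trans (≡.sym (x≡+mult (class c))) x≡0)))
                                   (∈-expand⇒mult-positive mult (allSubsets t) (∈-lookup c))

  pair-counted : ∀ c {i j} → i ∈ class c → j ∈ class c → + 1 ℤ.≤ Σ∋₂ x i j
  pair-counted c {i} {j} i∈ j∈ =
    subst (+ 1 ℤ.≤_) (≡.sym (sumℤ-filter≡count (λ A → (i ∈? A) ×-dec (j ∈? A))))
      (+≤+ (∈-filter⇒count-positive (λ A → (i ∈? A) ×-dec (j ∈? A)) {palette} (∈-lookup c) (i∈ , j∈)))

  colourAt-injective : ∀ i {u v} (τu≡i : τ P u ≡ i) (τv≡i : τ P v ≡ i) → size P i ≤ slots i →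
                       colourAt i τu≡i ≡ colourAt i τv≡i → u ≡ v
  colourAt-injective i τu≡i τv≡i fits eq =
    rank-injective P τu≡i τv≡i
      (clamp-injective (slots-positive i) fits (select-injective (i ∈?_) palette eq))

  collision : ∀ {u v} → u ≢ v → τ P u ≡ τ P v → colour u ≡ colour v →
              Σ∋ x (τ P u) ℤ.< + size P (τ P u)
  collision {u} {v} u≢v τu≡τv eq with size P (τ P u) ≤? slots (τ P u)
  ... | yes fits = ⊥-elim (u≢v (colourAt-injective (τ P u) refl (≡.sym τu≡τv) fits
                                  (trans eq (≡.sym (colourAt≡colour (≡.sym τu≡τv))))))
  ... | no ¬fits = subst (ℤ._< + size P (τ P u)) (≡.sym (sumℤ-filter≡count (τ P u ∈?_))) (+<+ (≰⇒> ¬fits))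

module StarFromClasses {n t c} {G : SimpleGraph n} (P : TypePartition G t) (k : ℕ) (x : Subset t → ℤ)
  (c0 : C0 P k x) (c2 : C2 P k x) (c4 : C4 P k x) (c5 : C5 P k x) (c6 : C6 P k x)
  (f : Fin n → Fin c) (class : Fin c → Subset t)
  (type∈class : ∀ v → τ P v ∈ class (f v))
  (class-nonzero : ∀ c → x (class c) ≢ + 0)
  (pair-counted : ∀ c {i j} → i ∈ class c → j ∈ class c → + 1 ℤ.≤ Σ∋₂ x i j)
  (collision : ∀ {u v} → u ≢ v → τ P u ≡ τ P v → f u ≡ f v → Σ∋ x (τ P u) ℤ.< + size P (τ P u))
  where

  Deficient : Fin t → Set
  Deficient i = cliq P i ≡ false × Σ∋ x i ℤ.< + size P i

  type∈sharedClass : ∀ {u v} → f u ≡ f v → τ P v ∈ class (f u)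
  type∈sharedClass {v = v} eq = subst (λ c → τ P v ∈ class c) (≡.sym eq) (type∈class v)

  sharedColour-counted : ∀ {u v} → f u ≡ f v → + 1 ℤ.≤ Σ∋₂ x (τ P u) (τ P v)
  sharedColour-counted {u} eq = pair-counted (f u) (type∈class u) (type∈sharedClass eq)

  sharedColour⇒¬Adj : ∀ {u v} → f u ≡ f v → ¬ Adj P (τ P u) (τ P v)
  sharedColour⇒¬Adj {u} eq adj = class-nonzero (f u) (c0 _ _ _ (type∈class u) (type∈sharedClass eq) adj)

  adjacentTypes⇒distinctColours : ∀ {u u′ v w} → E G v w → τ P v ≢ τ P w →
                                   τ P u ≡ τ P v → τ P u′ ≡ τ P w → f u ≢ f u′
  adjacentTypes⇒distinctColours vw τv≢τw τu≡τv τu′≡τw eq =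
    sharedColour⇒¬Adj eq (subst₂ (Adj P) (≡.sym τu≡τv) (≡.sym τu′≡τw) (edge⇒Adj P vw τv≢τw))

  sharedColour-sameType⇒deficient : ∀ {u v} → u ≢ v → τ P u ≡ τ P v → f u ≡ f v → Deficient (τ P u)
  sharedColour-sameType⇒deficient {u} u≢v τu≡τv eq with cliq P (τ P u) in cliqueType
  ... | true  = ⊥-elim (ℤ.<-irrefl (c2 _ cliqueType) (collision u≢v τu≡τv eq))
  ... | false = refl , collision u≢v τu≡τv eq

  deficient-edge⇒distinctTypes : ∀ {u v} → Deficient (τ P u) → E G u v → τ P u ≢ τ P v
  deficient-edge⇒distinctTypes (independent , _) uv τu≡τv = indepOK P _ _ τu≡τv independent uv

  proper : Proper G f
  proper u v uv eq with τ P u ≟ τ P v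
  ... | yes τu≡τv = indepOK P u v τu≡τv
                      (proj₁ (sharedColour-sameType⇒deficient (λ { refl → irrefl G uv }) τu≡τv eq)) uv
  ... | no τu≢τv  = adjacentTypes⇒distinctColours uv τu≢τv refl refl eq

  noBicolouredP4-deficientEnds : ∀ {a b c d} → E G a b → E G c d → b ≢ d → f b ≡ f d →
                                 τ P a ≡ τ P c → Deficient (τ P a) → ⊥
  noBicolouredP4-deficientEnds {a} {b} {c} {d} ab cd b≢d bd τa≡τc deficientA
    with τ P b ≟ τ P d | deficient-edge⇒distinctTypes deficientA ab
  ... | yes τb≡τd | τa≢τb =
    ℤ.<-irrefl (proj₁ (c6 _ _ τa≢τb (proj₁ deficientA) (proj₁ deficientB)
                          (edge⇒Adj P (sym G ab) (τa≢τb ∘ ≡.sym)))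
                      (proj₂ deficientA))
               (proj₂ deficientB)
    where deficientB = sharedColour-sameType⇒deficient b≢d τb≡τd bd
  ... | no τb≢τd | τa≢τb =
    positive⇒≢0 (sharedColour-counted bd)
      (c5 _ _ _ τa≢τb τa≢τd τb≢τd (proj₁ deficientA) (edge⇒Adj P ab τa≢τb) adjAD (proj₂ deficientA))
    where
      τc≢τd = deficient-edge⇒distinctTypes (subst Deficient τa≡τc deficientA) cd
      τa≢τd = λ τa≡τd → τc≢τd (trans (≡.sym τa≡τc) τa≡τd)
      adjAD = subst (λ i → Adj P i (τ P d)) (≡.sym τa≡τc) (edge⇒Adj P cd τc≢τd)

  noBicolouredP4-distinctEnds : ∀ {a b c d} → E G a b → E G b c → E G c d →
                                τ P a ≢ τ P c → τ P b ≢ τ P d → f a ≡ f c → f b ≡ f d → ⊥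
  noBicolouredP4-distinctEnds {a} {b} {c} {d} ab bc cd τa≢τc τb≢τd ac bd
    with τ P a ≟ τ P b | τ P b ≟ τ P c | τ P c ≟ τ P d | τ P a ≟ τ P d
  ... | yes τa≡τb | _ | _ | _ =
    adjacentTypes⇒distinctColours bc (τa≢τc ∘ trans τa≡τb) τa≡τb refl ac
  ... | no τa≢τb | yes τb≡τc | _ | _ =
    adjacentTypes⇒distinctColours ab τa≢τb refl (≡.sym τb≡τc) ac
  ... | no _ | no τb≢τc | yes τc≡τd | _ =
    adjacentTypes⇒distinctColours bc τb≢τc refl (≡.sym τc≡τd) bd
  ... | no _ | no _ | no τc≢τd | yes τa≡τd =
    adjacentTypes⇒distinctColours cd τc≢τd refl τa≡τd (≡.sym ac)
  ... | no τa≢τb | no τb≢τc | no τc≢τd | no τa≢τd =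
    positive⇒≢0 (sharedColour-counted bd)
      (c4 _ _ _ _ τa≢τb τa≢τc τa≢τd τb≢τc τb≢τd τc≢τd
          (edge⇒Adj P (sym G ab) (τa≢τb ∘ ≡.sym)) (edge⇒Adj P bc τb≢τc) (edge⇒Adj P cd τc≢τd)
          (sharedColour-counted ac))

  noBicolouredP4 : ∀ {a b c d} → IsP4 G a b c d → f a ≡ f c → f b ≡ f d → ⊥
  noBicolouredP4 {a} {b} {c} {d} (_ , a≢c , _ , _ , b≢d , _ , ab , bc , cd) ac bd
    with τ P a ≟ τ P c | τ P b ≟ τ P d
  ... | yes τa≡τc | _ =
    noBicolouredP4-deficientEnds ab cd b≢d bd τa≡τc (sharedColour-sameType⇒deficient a≢c τa≡τc ac)
  ... | no _ | yes τb≡τd =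
    noBicolouredP4-deficientEnds (sym G cd) (sym G ab) (a≢c ∘ ≡.sym) (≡.sym ac) (≡.sym τb≡τd)
      (sharedColour-sameType⇒deficient (b≢d ∘ ≡.sym) (≡.sym τb≡τd) (≡.sym bd))
  ... | no τa≢τc | no τb≢τd = noBicolouredP4-distinctEnds ab bc cd τa≢τc τb≢τd ac bd

  threeColours : ∀ a b c d → IsP4 G a b c d → AtLeastThreeColours f a b c d
  threeColours a b c d p4@(_ , _ , _ , _ , _ , _ , ab , bc , cd) with f a ≟ f c | f b ≟ f d
  ... | no a≢c | _      = zero , suc zero , suc (suc zero) , proper a b ab , proper b c bc , a≢c
  ... | yes _  | no b≢d = suc zero , suc (suc zero) , suc (suc (suc zero)) , proper b c bc , proper c d cd , b≢d
  ... | yes ac | yes bd = ⊥-elim (noBicolouredP4 p4 ac bd)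

  starColoring : StarColoring G f
  starColoring = proper , threeColours


lemma1 : {n t : ℕ} (G : SimpleGraph n) (k : ℕ) → 0 < k →
         (P : TypePartition G t) →
         (∃[ x ] Feasible P k x) →
         ∃[ f ] StarColoring {n} {k} G f
lemma1 G k _ P (x , c0 , c1 , c2 , c3 , c4 , c5 , c6 , c7) =
  (λ v → inject≤ (colour v) palette-fits) ,
  StarColoring-∘-injective {G = G} {f = colour} (λ i → inject≤ i palette-fits) (inject≤-injective palette-fits palette-fits _ _) starColoring
  where
    open Palette P k x c1 c2 c3 c7
    open StarFromClasses P k x c0 c2 c4 c5 c6 colour class type∈class class-nonzero pair-counted collision
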